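{- For all integers $n\ge 2$ and $q\ge 1$, \[ M(n+1,q+2)\ge M(n,q)! \qquad\text{and}\qquad F(n+1,q+2)\ge M(n,q). \]
   Context: A word over an alphabet is a finite string of letters; a subword of $w$ is a string of consecutive letters of $w$. A word $w$ contains a pattern $P$ if there is a map assigning to each letter of $P$ a nonempty word (different letters may receive equal words) such that the word obtained from $P$ by replacing each letter by its assigned word is a subword of $w$; otherwise $w$ avoids $P$. The Zimin words are defined by $Z_1=x_1$ and $Z_n=Z_{n-1}x_nZ_{n-1}$ with $x_n$ a new letter. For an alphabet of size $q$ with a designated (distinguished) letter $d$, let $S(n,q)$ be the set of all words $w$ over this alphabet such that $w$ avoids $Z_n$ and every subword of $w$ not containing the letter $d$ avoids $Z_{n-1}$. Let $M(n,q)=|S(n,q)|$ and let $F(n,q)$ be the length of the longest word in $S(n,q)$. -}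

module Defs where

open import Data.Nat using (ℕ; zero; suc; _∸_)
open import Data.Fin using (Fin)
open import Data.List using (List; []; _∷_; _++_; concatMap; length)
open import Data.List.Membership.Propositional using (_∈_; _∉_)
open import Data.List.Relation.Unary.Unique.Propositional using (Unique)
open import Data.Product using (Σ; ∃; ∃-syntax; _×_)
open import Relation.Binary.PropositionalEquality using (_≡_; _≢_)
open import Relation.Nullary using (¬_)
open import Function.Bundles using (_⇔_)

Word : Set → Set
Word A = List A

Subword : {A : Set} → Word A → Word A → Set
Subword s w = ∃[ u ] ∃[ v ] (u ++ s ++ v ≡ w)

-- Patterns are words over the pattern-letters ℕ (x_i is represented by i).
Pattern : Set
Pattern = List ℕ

substitute : {A : Set} → (ℕ → Word A) → Pattern → Word A
substitute σ P = concatMap σ P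

Contains : {A : Set} → Word A → Pattern → Set
Contains {A} w P =
  ∃[ σ ] ((∀ x → x ∈ P → σ x ≢ []) × Subword (substitute {A} σ P) w)

Avoids : {A : Set} → Word A → Pattern → Set
Avoids w P = ¬ Contains w P

Zimin : ℕ → Pattern
Zimin zero = []
Zimin (suc n) = Zimin n ++ (n ∷ Zimin n)

InS : (n q : ℕ) → Fin q → Word (Fin q) → Set
InS n q d w =
  Avoids w (Zimin n) ×
  (∀ s → Subword s w → d ∉ s → Avoids s (Zimin (n ∸ 1)))

HasSizeM : (n q : ℕ) → Fin q → ℕ → Set
HasSizeM n q d m =
  Σ (List (Word (Fin q))) λ L →
    Unique L × (∀ w → (w ∈ L) ⇔ InS n q d w) × (length L ≡ m)

-- For n = 2, S(2,q) = {ε, d, dd}, so M(2,q) ≤ 3, while the six words Dʲ (1 ≤ j ≤ 6) are shorter than Z₃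
-- and lie in S(3,q+2).  For n ≥ 3 add a new designated letter D and a separator E, embed the old letters
-- by ι, and let ρ agree with ι except ρ(d) = D.  With S(n,q) = {h₁, …, h_m} and any arrangement b₁ … b_m of
-- it, the word
--   D ι(b₁) E ι(d) ρ(h₁) E D ι(b₂) E ι(d) ρ(h₂) E … D ι(b_m)
-- lies in S(n+1,q+2), and distinct arrangements give distinct words.  Consider an image X y X of Z_{n+1},
-- X an image of Z_n.  If X contains at most one E it lies in one block, impossible as blocks avoid Z_n, or
-- it is a square X₁ y₁ X₁ around one E; then the image X₁ of Z_{n-1} occurs in a plain block, so it has no
-- D, and in a relabelled block, where having no D means coming from a d-free factor of some hᵢ.  If X
-- contains two E's, both copies of X contain the factor E s E with s a block, which occurs only once as the
-- blocks are distinct.  In a D-free factor the block between two E's is relabelled and the next block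
-- starts with D, so an image of Z_n there ends with E; but such an image contains at least four E's.
module Submission where

open import Defs
open import Data.Nat using (ℕ; zero; suc; _+_; _*_; _^_; _≤_; _<_; z≤n; s≤s; _!; _≤?_)
open import Data.Nat.Properties
  using (≤-refl; ≤-trans; ≤-reflexive; <-irrefl; <⇒≢; ≰⇒>; m≤n⇒m≤1+n; n<1+n; n≤1+n; m≤n+m;
         +-identityʳ; +-suc; +-comm; +-mono-≤; suc-injective; ^-monoʳ-≤)
  renaming (_≟_ to _≟ℕ_)
open import Data.Nat.Divisibility using (∣⇒≤; m≤n⇒m!∣n!)
open import Data.Fin using (Fin; zero; punchIn)
open import Data.Fin.Properties using (_≟_; punchIn-injective; punchInᵢ≢i)
open import Data.List using (List; []; _∷_; _++_; length; map; concatMap; replicate; upTo)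
open import Data.List.Properties
  using (∷-injective; ∷-injectiveˡ; ∷-injectiveʳ; ++-assoc; ++-identityʳ; ++-conicalˡ; ++-conicalʳ;
         ++-cancelˡ; ++-identityˡ-unique; ++-monoid; length-++; length-map; length-replicate; map-injective;
         concatMap-++; length-++-≤ˡ; length-++-≤ʳ)
open import Data.List.Membership.Propositional using (_∈_; _∉_; find)
open import Data.List.Membership.Propositional.Properties
  using (∈-++⁺ˡ; ∈-++⁺ʳ; ∈-++⁻; ∈-map⁺; ∈-map⁻; ∈-∃++; ∈-upTo⁻)
open import Data.List.Relation.Unary.Any using (here; there)
import Data.List.Relation.Unary.Any.Properties as Any
open import Data.List.Relation.Unary.All as All using (All; []; _∷_)
import Data.List.Relation.Unary.All.Properties as All
open import Data.List.Relation.Unary.AllPairs using ([]; _∷_)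
open import Data.List.Relation.Unary.Unique.Propositional using (Unique)
open import Data.List.Relation.Unary.Unique.Propositional.Properties using (Unique[x∷xs]⇒x∉xs; ++⁺; upTo⁺)
import Data.List.Relation.Unary.Unique.Propositional.Properties as Unique
open import Data.Product using (Σ; ∃-syntax; _×_; _,_; proj₁; proj₂)
open import Data.Sum using (_⊎_; inj₁; inj₂)
open import Data.Empty using (⊥; ⊥-elim)
open import Relation.Nullary using (yes; no)
open import Relation.Binary.PropositionalEquality using (_≡_; _≢_; refl; sym; trans; cong; cong₂; subst; module ≡-Reasoning)
open import Relation.Binary.Definitions using (DecidableEquality)
open import Function.Bundles using (Equivalence)

module _ {A : Set} where

  levi : (a b c d : List A) → a ++ b ≡ c ++ d →
    (∃[ t ] (c ≡ a ++ t × b ≡ t ++ d)) ⊎ (∃[ t ] (a ≡ c ++ t × d ≡ t ++ b))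
  levi [] b c d eq = inj₁ (c , refl , eq)
  levi (x ∷ a) b [] d eq = inj₂ (x ∷ a , refl , sym eq)
  levi (x ∷ a) b (y ∷ c) d eq with ∷-injective eq
  ... | refl , eq′ with levi a b c d eq′
  ... | inj₁ (t , p , q) = inj₁ (t , cong (x ∷_) p , q)
  ... | inj₂ (t , p , q) = inj₂ (t , cong (x ∷_) p , q)

  subword-refl : (w : List A) → Subword w w
  subword-refl w = [] , [] , ++-identityʳ w

  subword-trans : {a b c : List A} → Subword a b → Subword b c → Subword a c
  subword-trans {a} (u , v , refl) (u′ , v′ , refl) = u′ ++ u , v ++ v′ , reassoc
    where
    open ≡-Reasoning
    reassoc : (u′ ++ u) ++ a ++ v ++ v′ ≡ u′ ++ (u ++ a ++ v) ++ v′
    reassoc = begin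
      (u′ ++ u) ++ a ++ v ++ v′   ≡⟨ ++-assoc u′ u _ ⟩
      u′ ++ u ++ a ++ v ++ v′     ≡⟨ cong (λ z → u′ ++ u ++ z) (sym (++-assoc a v v′)) ⟩
      u′ ++ u ++ (a ++ v) ++ v′   ≡⟨ cong (u′ ++_) (sym (++-assoc u (a ++ v) v′)) ⟩
      u′ ++ (u ++ a ++ v) ++ v′   ∎

  subword-prefix : (a b : List A) → Subword a (a ++ b)
  subword-prefix a b = [] , b , refl

  subword-suffix : (a b : List A) → Subword b (a ++ b)
  subword-suffix a b = a , [] , cong (a ++_) (++-identityʳ b)

  subword-length : {a b : List A} → Subword a b → length a ≤ length b
  subword-length {a} (u , v , refl) =
    ≤-trans (length-++-≤ˡ a) (length-++-≤ʳ (a ++ v) {u})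

  subword-∉ : {a w : List A} {x : A} → Subword a w → x ∉ w → x ∉ a
  subword-∉ (u , v , refl) x∉w x∈a = x∉w (∈-++⁺ʳ u (∈-++⁺ˡ x∈a))

  -- A square starting at the front would contain c a second time.
  square-subword-∷ : {c : A} {w X y : List A} → X ≢ [] → c ∉ w →
    Subword (X ++ y ++ X) (c ∷ w) → Subword (X ++ y ++ X) w
  square-subword-∷ {X = []} X≢[] _ _ = ⊥-elim (X≢[] refl)
  square-subword-∷ {c} {X = x ∷ X′} {y} _ c∉w ([] , v , eq) with ∷-injective eq
  ... | refl , eq′ = ⊥-elim (c∉w (subst (c ∈_) eq′ (∈-++⁺ˡ (∈-++⁺ʳ X′ (∈-++⁺ʳ y (here refl))))))
  square-subword-∷ _ _ (_ ∷ u , v , eq) = u , v , ∷-injectiveʳ eq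

  module _ {B : Set} (f : A → B) where

    map-++⁻ : (w : List A) (a b : List B) → map f w ≡ a ++ b →
      ∃[ w₁ ] ∃[ w₂ ] (w ≡ w₁ ++ w₂ × map f w₁ ≡ a × map f w₂ ≡ b)
    map-++⁻ w [] b eq = [] , w , refl , refl , eq
    map-++⁻ [] (x ∷ a) b ()
    map-++⁻ (z ∷ w) (x ∷ a) b eq with ∷-injective eq
    ... | refl , eq′ with map-++⁻ w a b eq′
    ... | w₁ , w₂ , refl , p , q = z ∷ w₁ , w₂ , refl , cong (f z ∷_) p , q

    subword-map⁻ : {s : List B} {w : List A} → Subword s (map f w) →
      ∃[ s′ ] (map f s′ ≡ s × Subword s′ w)
    subword-map⁻ {s} {w} (u , v , eq) with map-++⁻ w u (s ++ v) (sym eq)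
    ... | w₁ , w₂ , refl , _ , p with map-++⁻ w₂ s v p
    ... | s₁ , s₂ , refl , q , _ = s₁ , q , w₁ , s₂ , refl

    ∉-map : {b : B} {w : List A} → (∀ a → f a ≢ b) → b ∉ map f w
    ∉-map f≢b b∈ with ∈-map⁻ f b∈
    ... | a , _ , refl = f≢b a refl

-- a is an image of Z_k under a substitution by nonempty words.
ZiminImage : {A : Set} → ℕ → List A → Set
ZiminImage zero a = a ≡ []
ZiminImage (suc k) a = ∃[ X ] ∃[ y ] (ZiminImage k X × y ≢ [] × a ≡ X ++ y ++ X)

Zimin-< : ∀ k {x} → x ∈ Zimin k → x < k
Zimin-< (suc k) x∈ with ∈-++⁻ (Zimin k) x∈
... | inj₁ x∈′ = m≤n⇒m≤1+n (Zimin-< k x∈′)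
... | inj₂ (here refl) = n<1+n k
... | inj₂ (there x∈′) = m≤n⇒m≤1+n (Zimin-< k x∈′)

module _ {A : Set} where

  ZiminImage-≢[] : ∀ {k} {a : List A} → ZiminImage (suc k) a → a ≢ []
  ZiminImage-≢[] (X , y , _ , y≢[] , refl) a≡[] =
    y≢[] (++-conicalˡ y X (++-conicalʳ X (y ++ X) a≡[]))

  ZiminImage-square : ∀ k {a : List A} → ZiminImage (suc (suc k)) a →
    ∃[ Y ] ∃[ z ] (Y ≢ [] × a ≡ Y ++ z ++ Y)
  ZiminImage-square k (X , y , X-img , _ , refl) = X , y , ZiminImage-≢[] X-img , refl

  ZiminImage-∷ : ∀ k {P w : List A} {x : A} → ZiminImage (suc (suc k)) P → x ∉ w →
    Subword P (x ∷ w) → Subword P w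
  ZiminImage-∷ k P-img x∉w P⊑ with ZiminImage-square k P-img
  ... | Y , z , Y≢[] , refl = square-subword-∷ Y≢[] x∉w P⊑

  NonEmptyOn : (ℕ → List A) → Pattern → Set
  NonEmptyOn σ P = ∀ x → x ∈ P → σ x ≢ []

  substitute-image : ∀ k (σ : ℕ → List A) → NonEmptyOn σ (Zimin k) →
    ZiminImage k (substitute σ (Zimin k))
  substitute-image zero σ _ = refl
  substitute-image (suc k) σ σ≢[] =
    substitute σ (Zimin k) , σ k ,
    substitute-image k σ (λ x x∈ → σ≢[] x (∈-++⁺ˡ x∈)) ,
    σ≢[] k (∈-++⁺ʳ (Zimin k) (here refl)) ,
    concatMap-++ σ (Zimin k) (k ∷ Zimin k)

  substitute-cong : (σ τ : ℕ → List A) (P : Pattern) → (∀ x → x ∈ P → σ x ≡ τ x) →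
    substitute σ P ≡ substitute τ P
  substitute-cong σ τ [] _ = refl
  substitute-cong σ τ (x ∷ P) σ≡τ =
    cong₂ _++_ (σ≡τ x (here refl)) (substitute-cong σ τ P (λ y y∈ → σ≡τ y (there y∈)))

  image-substitute : ∀ k {a : List A} → ZiminImage k a →
    ∃[ σ ] (NonEmptyOn σ (Zimin k) × substitute σ (Zimin k) ≡ a)
  image-substitute zero refl = (λ _ → []) , (λ _ ()) , refl
  image-substitute (suc k) (X , y , X-img , y≢[] , refl) with image-substitute k X-img
  ... | σ , σ≢[] , σX = σ′ , σ′≢[] , σ′Z
    where
    σ′ : ℕ → List A
    σ′ x with x ≟ℕ k
    ... | yes _ = y
    ... | no _ = σ x
    σ′-old : ∀ x → x ∈ Zimin k → σ′ x ≡ σ x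
    σ′-old x x∈ with x ≟ℕ k
    ... | yes refl = ⊥-elim (<⇒≢ (Zimin-< k x∈) refl)
    ... | no _ = refl
    σ′-new : σ′ k ≡ y
    σ′-new with k ≟ℕ k
    ... | yes _ = refl
    ... | no k≢k = ⊥-elim (k≢k refl)
    σ′≢[] : NonEmptyOn σ′ (Zimin (suc k))
    σ′≢[] x x∈ with ∈-++⁻ (Zimin k) x∈
    ... | inj₁ x∈′ = subst (_≢ []) (sym (σ′-old x x∈′)) (σ≢[] x x∈′)
    ... | inj₂ (here refl) = subst (_≢ []) (sym σ′-new) y≢[]
    ... | inj₂ (there x∈′) = subst (_≢ []) (sym (σ′-old x x∈′)) (σ≢[] x x∈′)
    σ′X : substitute σ′ (Zimin k) ≡ X
    σ′X = trans (substitute-cong σ′ σ (Zimin k) σ′-old) σX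
    σ′Z : substitute σ′ (Zimin (suc k)) ≡ X ++ y ++ X
    σ′Z = trans (concatMap-++ σ′ (Zimin k) (k ∷ Zimin k)) (cong₂ _++_ σ′X (cong₂ _++_ σ′-new σ′X))

  contains⇒image : ∀ k {w : List A} → Contains w (Zimin k) → ∃[ a ] (ZiminImage k a × Subword a w)
  contains⇒image k (σ , σ≢[] , a⊑w) = substitute σ (Zimin k) , substitute-image k σ σ≢[] , a⊑w

  image⇒contains : ∀ k {w a : List A} → ZiminImage k a → Subword a w → Contains w (Zimin k)
  image⇒contains k a-img a⊑w with image-substitute k a-img
  ... | σ , σ≢[] , refl = σ , σ≢[] , a⊑w

  ZiminImage-map⁻ : {B : Set} (f : A → B) → (∀ {x y} → f x ≡ f y → x ≡ y) →
    ∀ k {s : List A} {a : List B} → ZiminImage k a → map f s ≡ a → ZiminImage k s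
  ZiminImage-map⁻ f f-inj zero {[]} _ _ = refl
  ZiminImage-map⁻ f f-inj zero {_ ∷ _} refl ()
  ZiminImage-map⁻ f f-inj (suc k) {s} (X , y , X-img , y≢[] , refl) fs≡
    with map-++⁻ f s X (y ++ X) fs≡
  ... | s₁ , s₂₃ , refl , fs₁ , fs₂₃ with map-++⁻ f s₂₃ y X fs₂₃
  ... | s₂ , s₃ , refl , fs₂ , fs₃ =
    s₁ , s₂ , ZiminImage-map⁻ f f-inj k X-img fs₁ ,
    (λ s₂≡[] → y≢[] (trans (sym fs₂) (cong (map f) s₂≡[]))) ,
    cong (λ z → s₁ ++ s₂ ++ z) (map-injective f-inj (trans fs₃ (sym fs₁)))

  substitute-length : (σ : ℕ → List A) (P : Pattern) → NonEmptyOn σ P →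
    length P ≤ length (substitute σ P)
  substitute-length σ [] _ = z≤n
  substitute-length σ (x ∷ P) σ≢[] with σ x | σ≢[] x (here refl)
  ... | [] | σx≢[] = ⊥-elim (σx≢[] refl)
  ... | z ∷ σx | _ = s≤s (≤-trans (substitute-length σ P (λ y y∈ → σ≢[] y (there y∈)))
                                 (length-++-≤ʳ (substitute σ P) {σx}))

  avoids-shorter : {w : List A} {P : Pattern} → length w < length P → Avoids w P
  avoids-shorter {w} {P} w<P (σ , σ≢[] , σP⊑w) =
    <-irrefl refl (≤-trans w<P (≤-trans (substitute-length σ P σ≢[]) (subword-length σP⊑w)))

Zimin-nonempty : ∀ n → 0 < length (Zimin (suc n))
Zimin-nonempty n = ≤-trans (s≤s z≤n) (length-++-≤ʳ (n ∷ Zimin n) {Zimin n})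

[]∈S : ∀ n {K} (D : Fin K) → InS (2 + n) K D []
[]∈S n D = avoids-shorter (Zimin-nonempty (suc n)) ,
           λ s s⊑[] _ → avoids-shorter (≤-trans (s≤s (subword-length s⊑[])) (Zimin-nonempty n))

module Separated {A : Set} (_≟A_ : DecidableEquality A) (c : A) where

  occurrences : List A → ℕ
  occurrences [] = 0
  occurrences (x ∷ xs) with x ≟A c
  ... | yes _ = suc (occurrences xs)
  ... | no _ = occurrences xs

  occurrences-++ : (xs ys : List A) → occurrences (xs ++ ys) ≡ occurrences xs + occurrences ys
  occurrences-++ [] ys = refl
  occurrences-++ (x ∷ xs) ys with x ≟A c
  ... | yes _ = cong suc (occurrences-++ xs ys)
  ... | no _ = occurrences-++ xs ys

  occurrences-∷ : (xs : List A) → occurrences (c ∷ xs) ≡ suc (occurrences xs)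
  occurrences-∷ xs with c ≟A c
  ... | yes _ = refl
  ... | no c≢c = ⊥-elim (c≢c refl)

  ∉⇒occurrences≡0 : (xs : List A) → c ∉ xs → occurrences xs ≡ 0
  ∉⇒occurrences≡0 [] _ = refl
  ∉⇒occurrences≡0 (x ∷ xs) c∉ with x ≟A c
  ... | yes x≡c = ⊥-elim (c∉ (here (sym x≡c)))
  ... | no _ = ∉⇒occurrences≡0 xs (λ c∈ → c∉ (there c∈))

  occurrences≡0⇒∉ : (xs : List A) → occurrences xs ≡ 0 → c ∉ xs
  occurrences≡0⇒∉ (x ∷ xs) #≡0 c∈ with x ≟A c | c∈
  ... | yes _ | _ with () ← #≡0
  ... | no x≢c | here refl = x≢c refl
  ... | no _ | there c∈′ = occurrences≡0⇒∉ xs #≡0 c∈′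

  occurrences-square : (X y : List A) →
    occurrences (X ++ y ++ X) ≡ occurrences X + (occurrences y + occurrences X)
  occurrences-square X y = trans (occurrences-++ X (y ++ X)) (cong (occurrences X +_) (occurrences-++ y X))

  occurrences-c-s-c : (a s : List A) → c ∉ a → c ∉ s → occurrences (a ++ c ∷ s ++ c ∷ []) ≡ 2
  occurrences-c-s-c a s c∉a c∉s = begin
    occurrences (a ++ c ∷ s ++ c ∷ [])           ≡⟨ occurrences-++ a _ ⟩
    occurrences a + occurrences (c ∷ s ++ c ∷ []) ≡⟨ cong₂ _+_ (∉⇒occurrences≡0 a c∉a) (occurrences-∷ _) ⟩
    suc (occurrences (s ++ c ∷ []))              ≡⟨ cong suc (occurrences-++ s _) ⟩
    suc (occurrences s + occurrences (c ∷ []))   ≡⟨ cong suc (cong₂ _+_ (∉⇒occurrences≡0 s c∉s) (occurrences-∷ [])) ⟩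
    2                                            ∎
    where open ≡-Reasoning

  occurrences≤1-tail : (a₁ a₂ : List A) → occurrences (a₁ ++ c ∷ a₂) ≤ 1 → c ∉ a₂
  occurrences≤1-tail a₁ a₂ #≤1 = occurrences≡0⇒∉ a₂ (n+1+m≤1⇒m≡0 (occurrences a₁) (occurrences a₂)
    (subst (_≤ 1) (trans (occurrences-++ a₁ (c ∷ a₂)) (cong (occurrences a₁ +_) (occurrences-∷ a₂))) #≤1))
    where
    n+1+m≤1⇒m≡0 : ∀ n m → n + suc m ≤ 1 → m ≡ 0
    n+1+m≤1⇒m≡0 zero zero _ = refl
    n+1+m≤1⇒m≡0 zero (suc m) (s≤s ())
    n+1+m≤1⇒m≡0 (suc n) m (s≤s le) with () ← subst (_≤ 0) (+-suc n m) le

  occurrences≤1-square : (X y : List A) → occurrences (X ++ y ++ X) ≤ 1 → c ∉ X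
  occurrences≤1-square X y #≤1 = occurrences≡0⇒∉ X (n+m+n≤1⇒n≡0 (occurrences X) (occurrences y)
    (subst (_≤ 1) (occurrences-square X y) #≤1))
    where
    n+m+n≤1⇒n≡0 : ∀ n m → n + (m + n) ≤ 1 → n ≡ 0
    n+m+n≤1⇒n≡0 zero m _ = refl
    n+m+n≤1⇒n≡0 (suc n) m (s≤s le) with () ← subst (_≤ 0) (trans (cong (n +_) (+-suc m n)) (+-suc n (m + n))) le

  first-occurrence : (xs : List A) → c ∈ xs → ∃[ a ] ∃[ b ] (xs ≡ a ++ c ∷ b × c ∉ a)
  first-occurrence (x ∷ xs) c∈ with x ≟A c | c∈
  ... | yes refl | _ = [] , xs , refl , λ ()
  ... | no x≢c | here refl = ⊥-elim (x≢c refl)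
  ... | no x≢c | there c∈′ with first-occurrence xs c∈′
  ... | a , b , refl , c∉a = x ∷ a , b , refl , λ { (here refl) → x≢c refl ; (there c∈a) → c∉a c∈a }

  occurrences>0⇒∈ : (xs : List A) → 1 ≤ occurrences xs → c ∈ xs
  occurrences>0⇒∈ (x ∷ xs) #≥1 with x ≟A c
  ... | yes refl = here refl
  ... | no _ = there (occurrences>0⇒∈ xs #≥1)

  first-two-occurrences : (xs : List A) → 2 ≤ occurrences xs →
    ∃[ a ] ∃[ s ] ∃[ b ] (xs ≡ a ++ c ∷ s ++ c ∷ b × c ∉ a × c ∉ s)
  first-two-occurrences xs #≥2 with first-occurrence xs (occurrences>0⇒∈ xs (≤-trans (s≤s z≤n) #≥2))
  ... | a , b , refl , c∉a with first-occurrence b (occurrences>0⇒∈ b #b≥1)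
    where
    #b≥1 : 1 ≤ occurrences b
    #b≥1 with s≤s le ← subst (2 ≤_) (trans (occurrences-++ a (c ∷ b))
                          (cong₂ _+_ (∉⇒occurrences≡0 a c∉a) (occurrences-∷ b))) #≥2 = le
  ... | s , b′ , refl , c∉s = a , s , b′ , refl , c∉a , c∉s

  square-ending-in-c : (X y w : List A) → X ≢ [] → X ++ y ++ X ≡ w ++ c ∷ [] →
    ∃[ X′ ] (X ≡ X′ ++ c ∷ [])
  square-ending-in-c X y w X≢[] eq with levi (X ++ y) X w (c ∷ []) (trans (++-assoc X y X) eq)
  ... | inj₁ (t , _ , X≡) = t , X≡
  ... | inj₂ ([] , _ , c≡X) = [] , sym c≡X
  ... | inj₂ (_ ∷ [] , _ , c≡) = ⊥-elim (X≢[] (sym (∷-injectiveʳ c≡)))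

  occurrences-∷ʳ : (w : List A) → 1 ≤ occurrences (w ++ c ∷ [])
  occurrences-∷ʳ w = subst (1 ≤_) (sym (trans (occurrences-++ w (c ∷ [])) (cong (occurrences w +_) (occurrences-∷ []))))
    (m≤n+m 1 (occurrences w))

  ZiminImage-ending-in-c : ∀ k {a w : List A} → ZiminImage (suc k) a → a ≡ w ++ c ∷ [] →
    2 ^ k ≤ occurrences a
  ZiminImage-ending-in-c zero {w = w} (_ , _ , refl , _ , refl) eq =
    subst (λ z → 1 ≤ occurrences z) (sym eq) (occurrences-∷ʳ w)
  ZiminImage-ending-in-c (suc k) {w = w} (X , y , X-img , _ , refl) eq
    with square-ending-in-c X y w (ZiminImage-≢[] X-img) eq
  ... | X′ , X≡ = subst (2 ^ suc k ≤_) (sym (occurrences-square X y))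
    (+-mono-≤ #X (≤-trans (≤-reflexive (+-identityʳ (2 ^ k))) (≤-trans #X (m≤n+m _ (occurrences y)))))
    where
    #X : 2 ^ k ≤ occurrences X
    #X = ZiminImage-ending-in-c k X-img X≡

  split-at-first : (x z a b : List A) → x ++ c ∷ z ≡ a ++ c ∷ b → c ∉ a →
    (x ≡ a × z ≡ b) ⊎ (∃[ x′ ] (x ≡ a ++ c ∷ x′ × b ≡ x′ ++ c ∷ z))
  split-at-first x z a b eq c∉a with levi x (c ∷ z) a (c ∷ b) eq
  ... | inj₁ ([] , a≡ , cz≡) = inj₁ (sym (trans a≡ (++-identityʳ x)) , ∷-injectiveʳ cz≡)
  ... | inj₁ (_ ∷ _ , refl , cz≡) with refl ← ∷-injectiveˡ cz≡ = ⊥-elim (c∉a (∈-++⁺ʳ x (here refl)))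
  ... | inj₂ ([] , x≡ , cb≡) = inj₁ (trans x≡ (++-identityʳ a) , sym (∷-injectiveʳ cb≡))
  ... | inj₂ (_ ∷ t , x≡ , cb≡) with refl , b≡ ← ∷-injective cb≡ = inj₂ (t , x≡ , b≡)

  square-around-c : (P x s₁ s₂ : List A) → c ∉ P → P ++ x ++ P ≡ s₁ ++ c ∷ s₂ →
    ∃[ p ] ∃[ r ] (s₁ ≡ P ++ p × s₂ ≡ r ++ P)
  square-around-c P x s₁ s₂ c∉P eq with levi P (x ++ P) s₁ (c ∷ s₂) eq
  square-around-c P [] s₁ s₂ c∉P eq | inj₂ ([] , _ , cs₂≡P) = ⊥-elim (c∉P (subst (c ∈_) cs₂≡P (here refl)))
  square-around-c P (_ ∷ x) s₁ s₂ c∉P eq | inj₂ ([] , P≡ , cs₂≡) =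
    [] , x , trans (sym (trans P≡ (++-identityʳ s₁))) (sym (++-identityʳ P)) , ∷-injectiveʳ cs₂≡
  ... | inj₂ (_ ∷ _ , P≡ , cs₂≡) with refl ← ∷-injectiveˡ cs₂≡ =
    ⊥-elim (c∉P (subst (c ∈_) (sym P≡) (∈-++⁺ʳ s₁ (here refl))))
  ... | inj₁ (t , s₁≡ , xP≡) with levi x P t (c ∷ s₂) xP≡
  ...   | inj₁ (t′ , _ , P≡) = ⊥-elim (c∉P (subst (c ∈_) (sym P≡) (∈-++⁺ʳ t′ (here refl))))
  ...   | inj₂ ([] , _ , cs₂≡) = ⊥-elim (c∉P (subst (c ∈_) cs₂≡ (here refl)))
  ...   | inj₂ (_ ∷ t′ , _ , cs₂≡) = t , t′ , s₁≡ , ∷-injectiveʳ cs₂≡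

  subword-around-c : {a X Y : List A} → Subword a (X ++ c ∷ Y) →
    Subword a X ⊎ Subword a Y ⊎
    (∃[ a₁ ] ∃[ a₂ ] (a ≡ a₁ ++ c ∷ a₂ × Subword a₁ X × ∃[ v ] (a₂ ++ v ≡ Y)))
  subword-around-c {a} {X} {Y} (u , v , eq) with levi u (a ++ v) X (c ∷ Y) eq
  ... | inj₂ ([] , _ , cY≡) with a
  ...   | [] = inj₁ ([] , X , refl)
  ...   | _ ∷ a′ with refl , Y≡ ← ∷-injective cY≡ = inj₂ (inj₂ ([] , a′ , refl , ([] , X , refl) , v , sym Y≡))
  subword-around-c {a} {X} {Y} (u , v , eq) | inj₂ (_ ∷ t , _ , cY≡) with refl , Y≡ ← ∷-injective cY≡ =
    inj₂ (inj₁ (t , v , sym Y≡))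
  subword-around-c {a} {X} {Y} (u , v , eq) | inj₁ (t , X≡ , av≡) with levi a v t (c ∷ Y) av≡
  ... | inj₁ (t′ , t≡ , _) = inj₁ (u , t′ , trans (cong (u ++_) (sym t≡)) (sym X≡))
  ... | inj₂ ([] , a≡ , _) =
    inj₁ (u , [] , trans (cong (λ z → u ++ z ++ []) (trans a≡ (++-identityʳ t)))
                   (trans (cong (u ++_) (++-identityʳ t)) (sym X≡)))
  ... | inj₂ (_ ∷ t″ , a≡ , cY≡) with refl , Y≡ ← ∷-injective cY≡ =
    inj₂ (inj₂ (t , t″ , a≡ , (u , [] , trans (cong (u ++_) (++-identityʳ t)) (sym X≡)) , v , sym Y≡))

  glue : List A → List (List A) → List A
  glue s₀ [] = s₀
  glue s₀ (s₁ ∷ ss) = s₀ ++ c ∷ glue s₁ ss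

  data Adjacent : List A → List A → List A → List (List A) → Set where
    here : ∀ {s₀ s₁ ss} → Adjacent s₀ s₁ s₀ (s₁ ∷ ss)
    there : ∀ {s t s₀ s₁ ss} → Adjacent s t s₁ ss → Adjacent s t s₀ (s₁ ∷ ss)

  glue-∷ : (x : A) (s : List A) (ts : List (List A)) → ∃[ w ] (glue (x ∷ s) ts ≡ x ∷ w)
  glue-∷ x s [] = s , refl
  glue-∷ x s (_ ∷ _) = _ , refl

  length-glue : (s₀ : List A) (ss : List (List A)) → length s₀ + length ss ≤ length (glue s₀ ss)
  length-glue s₀ [] = ≤-reflexive (+-identityʳ (length s₀))
  length-glue s₀ (s₁ ∷ ss) = subst (length s₀ + suc (length ss) ≤_) (sym (length-++ s₀))
    (+-mono-≤ (≤-refl {length s₀}) (s≤s (≤-trans (m≤n+m (length ss) (length s₁)) (length-glue s₁ ss))))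

  glue-free-prefix : (s₀ : List A) (ss : List (List A)) (a v : List A) →
    a ++ v ≡ glue s₀ ss → c ∉ a → Subword a s₀
  glue-free-prefix s₀ [] a v eq _ = [] , v , eq
  glue-free-prefix s₀ (s₁ ∷ ss) a v eq c∉a with levi a v s₀ (c ∷ glue s₁ ss) eq
  ... | inj₁ (t , s₀≡ , _) = [] , t , sym s₀≡
  ... | inj₂ ([] , a≡ , _) = [] , [] , trans (++-identityʳ a) (trans a≡ (++-identityʳ s₀))
  ... | inj₂ (_ ∷ _ , a≡ , cg≡) with refl ← ∷-injectiveˡ cg≡ =
    ⊥-elim (c∉a (subst (c ∈_) (sym a≡) (∈-++⁺ʳ s₀ (here refl))))

  glue-subword : (s₀ : List A) (ss : List (List A)) {a : List A} →
    Subword a (glue s₀ ss) → occurrences a ≤ 1 →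
    (∃[ s ] (s ∈ s₀ ∷ ss × Subword a s)) ⊎
    (∃[ s ] ∃[ t ] ∃[ a₁ ] ∃[ a₂ ]
      (Adjacent s t s₀ ss × a ≡ a₁ ++ c ∷ a₂ × Subword a₁ s × Subword a₂ t))
  glue-subword s₀ [] a⊑ _ = inj₁ (s₀ , here refl , a⊑)
  glue-subword s₀ (s₁ ∷ ss) a⊑ #≤1 with subword-around-c {X = s₀} a⊑
  ... | inj₁ a⊑s₀ = inj₁ (s₀ , here refl , a⊑s₀)
  ... | inj₂ (inj₁ a⊑g) with glue-subword s₁ ss a⊑g #≤1
  ...   | inj₁ (s , s∈ , a⊑s) = inj₁ (s , there s∈ , a⊑s)
  ...   | inj₂ (s , t , a₁ , a₂ , adj , a≡ , a₁⊑ , a₂⊑) = inj₂ (s , t , a₁ , a₂ , there adj , a≡ , a₁⊑ , a₂⊑)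
  glue-subword s₀ (s₁ ∷ ss) a⊑ #≤1 | inj₂ (inj₂ (a₁ , a₂ , refl , a₁⊑ , v , a₂v≡)) =
    inj₂ (s₀ , s₁ , a₁ , a₂ , here , refl , a₁⊑ ,
          glue-free-prefix s₁ ss a₂ v a₂v≡ (occurrences≤1-tail a₁ a₂ #≤1))

  glue-between-c : (s₀ : List A) (ss : List (List A)) (x s y : List A) →
    All (c ∉_) (s₀ ∷ ss) → c ∉ s → glue s₀ ss ≡ x ++ c ∷ s ++ c ∷ y →
    s ∈ ss × ∃[ t ] ∃[ ts ] (Adjacent s t s₀ ss × y ≡ glue t ts)
  glue-between-c s₀ [] x s y (c∉s₀ ∷ _) _ eq = ⊥-elim (c∉s₀ (subst (c ∈_) (sym eq) (∈-++⁺ʳ x (here refl))))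
  glue-between-c s₀ (s₁ ∷ ss) x s y (c∉s₀ ∷ free) c∉s eq
    with split-at-first x (s ++ c ∷ y) s₀ (glue s₁ ss) (sym eq) c∉s₀
  ... | inj₂ (x′ , _ , eq′) with glue-between-c s₁ ss x′ s y free c∉s eq′
  ...   | s∈ , t , ts , adj , y≡ = there s∈ , t , ts , there adj , y≡
  glue-between-c s₀ (s₁ ∷ []) x s y (_ ∷ c∉s₁ ∷ _) _ eq | inj₁ (_ , s₁≡) =
    ⊥-elim (c∉s₁ (subst (c ∈_) s₁≡ (∈-++⁺ʳ s (here refl))))
  glue-between-c s₀ (s₁ ∷ s₂ ∷ ss) x s y (_ ∷ c∉s₁ ∷ _) c∉s eq | inj₁ (_ , eq′)
    with split-at-first s y s₁ (glue s₂ ss) eq′ c∉s₁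
  ... | inj₁ (refl , y≡) = here refl , s₂ , ss , there here , y≡
  ... | inj₂ (_ , s≡ , _) = ⊥-elim (c∉s (subst (c ∈_) (sym s≡) (∈-++⁺ʳ s₁ (here refl))))

  glue-first-stretch : (s s₁ y : List A) (ss : List (List A)) → c ∉ s → c ∉ s₁ →
    s ++ c ∷ y ≡ glue s₁ ss → s ≡ s₁
  glue-first-stretch s s₁ y [] _ c∉s₁ eq = ⊥-elim (c∉s₁ (subst (c ∈_) eq (∈-++⁺ʳ s (here refl))))
  glue-first-stretch s s₁ y (s₂ ∷ ss) c∉s c∉s₁ eq with split-at-first s y s₁ (glue s₂ ss) eq c∉s₁
  ... | inj₁ (s≡s₁ , _) = s≡s₁
  ... | inj₂ (_ , s≡ , _) = ⊥-elim (c∉s (subst (c ∈_) (sym s≡) (∈-++⁺ʳ s₁ (here refl))))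

  glue-c-stretch-c-unique : (s₀ : List A) (ss : List (List A)) (x₁ y₁ x₂ y₂ s : List A) →
    All (c ∉_) (s₀ ∷ ss) → c ∉ s → Unique (s₀ ∷ ss) →
    glue s₀ ss ≡ x₁ ++ c ∷ s ++ c ∷ y₁ → glue s₀ ss ≡ x₂ ++ c ∷ s ++ c ∷ y₂ → x₁ ≡ x₂
  glue-c-stretch-c-unique s₀ [] x₁ _ _ _ _ (c∉s₀ ∷ _) _ _ eq₁ _ =
    ⊥-elim (c∉s₀ (subst (c ∈_) (sym eq₁) (∈-++⁺ʳ x₁ (here refl))))
  glue-c-stretch-c-unique s₀ (s₁ ∷ ss) x₁ y₁ x₂ y₂ s (c∉s₀ ∷ free) c∉s (_ ∷ distinct) eq₁ eq₂
    with split-at-first x₁ (s ++ c ∷ y₁) s₀ (glue s₁ ss) (sym eq₁) c∉s₀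
       | split-at-first x₂ (s ++ c ∷ y₂) s₀ (glue s₁ ss) (sym eq₂) c∉s₀
  ... | inj₁ (x₁≡ , _) | inj₁ (x₂≡ , _) = trans x₁≡ (sym x₂≡)
  ... | inj₂ (x₁′ , x₁≡ , eq₁′) | inj₂ (x₂′ , x₂≡ , eq₂′) =
    trans x₁≡ (trans (cong (λ z → s₀ ++ c ∷ z)
      (glue-c-stretch-c-unique s₁ ss x₁′ y₁ x₂′ y₂ s free c∉s distinct eq₁′ eq₂′)) (sym x₂≡))
  ... | inj₁ (_ , eq₁′) | inj₂ (x₂′ , _ , eq₂′) =
    ⊥-elim (Unique[x∷xs]⇒x∉xs distinct (subst (_∈ ss) (glue-first-stretch s s₁ y₁ ss c∉s (All.head free) eq₁′)
      (proj₁ (glue-between-c s₁ ss x₂′ s y₂ free c∉s eq₂′))))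
  ... | inj₂ (x₁′ , _ , eq₁′) | inj₁ (_ , eq₂′) =
    ⊥-elim (Unique[x∷xs]⇒x∉xs distinct (subst (_∈ ss) (glue-first-stretch s s₁ y₂ ss c∉s (All.head free) eq₂′)
      (proj₁ (glue-between-c s₁ ss x₁′ s y₁ free c∉s eq₁′))))

  glue-injective : ∀ s₀ ss t₀ ts → All (c ∉_) (s₀ ∷ ss) → All (c ∉_) (t₀ ∷ ts) →
    glue s₀ ss ≡ glue t₀ ts → s₀ ≡ t₀ × ss ≡ ts
  glue-injective s₀ [] t₀ [] _ _ eq = eq , refl
  glue-injective s₀ [] t₀ (_ ∷ _) (c∉s₀ ∷ _) _ eq = ⊥-elim (c∉s₀ (subst (c ∈_) (sym eq) (∈-++⁺ʳ t₀ (here refl))))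
  glue-injective s₀ (_ ∷ _) t₀ [] _ (c∉t₀ ∷ _) eq = ⊥-elim (c∉t₀ (subst (c ∈_) eq (∈-++⁺ʳ s₀ (here refl))))
  glue-injective s₀ (s₁ ∷ ss) t₀ (t₁ ∷ ts) (c∉s₀ ∷ free-s) (c∉t₀ ∷ free-t) eq
    with split-at-first s₀ (glue s₁ ss) t₀ (glue t₁ ts) eq c∉t₀
  ... | inj₁ (s₀≡t₀ , eq′) with glue-injective s₁ ss t₁ ts free-s free-t eq′
  ...   | s₁≡t₁ , ss≡ts = s₀≡t₀ , cong₂ _∷_ s₁≡t₁ ss≡ts
  glue-injective s₀ (s₁ ∷ ss) t₀ (t₁ ∷ ts) (c∉s₀ ∷ _) _ eq | inj₂ (_ , s₀≡ , _) =
    ⊥-elim (c∉s₀ (subst (c ∈_) (sym s₀≡) (∈-++⁺ʳ t₀ (here refl))))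

module _ {A B : Set} where

  Unique-map⁺-on : (f : A → B) {xs : List A} → (∀ {x y} → x ∈ xs → y ∈ xs → f x ≡ f y → x ≡ y) →
    Unique xs → Unique (map f xs)
  Unique-map⁺-on f {[]} _ [] = []
  Unique-map⁺-on f {x ∷ xs} f-inj (x∉xs ∷ distinct) =
    All.tabulate fx≢ ∷ Unique-map⁺-on f (λ x∈ y∈ → f-inj (there x∈) (there y∈)) distinct
    where
    fx≢ : ∀ {v} → v ∈ map f xs → f x ≢ v
    fx≢ v∈ fx≡ with ∈-map⁻ f v∈
    ... | y , y∈ , refl = All.lookup x∉xs y∈ (f-inj (here refl) (there y∈) fx≡)

  length-concatMap : (f : A → List B) (l : List A) (n : ℕ) → (∀ {x} → x ∈ l → length (f x) ≡ n) →
    length (concatMap f l) ≡ length l * n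
  length-concatMap f [] n _ = refl
  length-concatMap f (x ∷ l) n len≡ =
    trans (length-++ (f x)) (cong₂ _+_ (len≡ (here refl)) (length-concatMap f l n (λ x∈ → len≡ (there x∈))))

module Permutations {A : Set} where

  select : List A → List (A × List A)
  select [] = []
  select (x ∷ xs) = (x , xs) ∷ map (λ p → proj₁ p , x ∷ proj₂ p) (select xs)

  permutations : ℕ → List A → List (List A)
  headed : ℕ → A × List A → List (List A)

  permutations zero _ = [] ∷ []
  permutations (suc n) xs = concatMap (headed n) (select xs)

  headed n (y , r) = map (y ∷_) (permutations n r)

  length-select : ∀ xs → length (select xs) ≡ length xs
  length-select [] = refl
  length-select (x ∷ xs) = cong suc (trans (length-map _ (select xs)) (length-select xs))

  map-proj₁-select : ∀ xs → map proj₁ (select xs) ≡ xs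
  map-proj₁-select [] = refl
  map-proj₁-select (x ∷ xs) = cong (x ∷_) (trans (map-proj₁-shift (select xs)) (map-proj₁-select xs))
    where
    map-proj₁-shift : ∀ (l : List (A × List A)) → map proj₁ (map (λ p → proj₁ p , x ∷ proj₂ p) l) ≡ map proj₁ l
    map-proj₁-shift [] = refl
    map-proj₁-shift (p ∷ l) = cong (proj₁ p ∷_) (map-proj₁-shift l)

  Selection : List A → A × List A → Set
  Selection xs (y , r) = y ∈ xs × All (_∈ xs) r × suc (length r) ≡ length xs × (Unique xs → Unique (y ∷ r))

  ∈-select⁻ : ∀ xs {p} → p ∈ select xs → Selection xs p
  ∈-select⁻ (x ∷ xs) (here refl) = here refl , All.tabulate there , refl , λ distinct → distinct
  ∈-select⁻ (x ∷ xs) (there p∈) with ∈-map⁻ _ p∈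
  ... | (y , r) , p∈′ , refl with ∈-select⁻ xs p∈′
  ... | y∈ , r⊆ , len≡ , unique-yr = there y∈ , here refl ∷ All.map there r⊆ , cong suc len≡ , unique
    where
    unique : Unique (x ∷ xs) → Unique (y ∷ x ∷ r)
    unique (x∉xs ∷ distinct) with y∉r ∷ distinct-r ← unique-yr distinct =
      ((λ y≡x → All.lookup x∉xs y∈ (sym y≡x)) ∷ y∉r)
      ∷ (All.map (λ z∈ x≡z → All.lookup x∉xs z∈ x≡z) r⊆ ∷ distinct-r)

  length-permutations : ∀ n xs → length xs ≡ n → length (permutations n xs) ≡ n !
  length-permutations zero _ _ = refl
  length-permutations (suc n) xs len≡ =
    trans (length-concatMap (headed n) (select xs) (n !) length-block) (cong (_* n !) (trans (length-select xs) len≡))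
    where
    length-block : ∀ {p} → p ∈ select xs → length (headed n p) ≡ n !
    length-block {y , r} p∈ with _ , _ , len-r , _ ← ∈-select⁻ xs p∈ =
      trans (length-map (y ∷_) (permutations n r)) (length-permutations n r (suc-injective (trans len-r len≡)))

  Arrangement : List A → ℕ → List A → Set
  Arrangement xs n p = Unique p × All (_∈ xs) p × length p ≡ n

  ∈-permutations⁻ : ∀ n xs → length xs ≡ n → Unique xs → ∀ {p} → p ∈ permutations n xs → Arrangement xs n p
  ∈-permutations⁻ zero _ _ _ (here refl) = [] , [] , refl
  ∈-permutations⁻ (suc n) xs len≡ distinct p∈ with find (Any.concatMap⁻ (headed n) p∈)
  ... | (y , r) , yr∈ , p∈′ with ∈-map⁻ _ p∈′ | ∈-select⁻ xs yr∈
  ... | p′ , p′∈ , refl | y∈ , r⊆ , len-r , unique-yr with unique-yr distinct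
  ... | y∉r ∷ distinct-r with ∈-permutations⁻ n r (suc-injective (trans len-r len≡)) distinct-r p′∈
  ... | distinct-p′ , p′⊆ , len-p′ =
    All.tabulate (λ z∈ → All.lookup y∉r (All.lookup p′⊆ z∈)) ∷ distinct-p′ ,
    y∈ ∷ All.map (All.lookup r⊆) p′⊆ ,
    cong suc len-p′

  permutations-unique : ∀ n xs → length xs ≡ n → Unique xs → Unique (permutations n xs)
  permutations-unique zero _ _ _ = [] ∷ []
  permutations-unique (suc n) xs len≡ distinct =
    unique-blocks (select xs) (subst Unique (sym (map-proj₁-select xs)) distinct) unique-block
    where
    unique-block : ∀ {p} → p ∈ select xs → Unique (permutations n (proj₂ p))
    unique-block p∈ with _ , _ , len-r , unique-yr ← ∈-select⁻ xs p∈ | unique-yr distinct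
    ... | _ ∷ distinct-r = permutations-unique n _ (suc-injective (trans len-r len≡)) distinct-r
    -- Blocks with distinct heads are disjoint.
    unique-blocks : ∀ (l : List (A × List A)) → Unique (map proj₁ l) →
      (∀ {p} → p ∈ l → Unique (permutations n (proj₂ p))) →
      Unique (concatMap (headed n) l)
    unique-blocks [] _ _ = []
    unique-blocks ((y , r) ∷ l) (y∉ ∷ distinct-l) unique-p =
      ++⁺ (Unique.map⁺ ∷-injectiveʳ (unique-p (here refl)))
          (unique-blocks l distinct-l (λ p∈ → unique-p (there p∈)))
          disjoint
      where
      disjoint : ∀ {v} → v ∈ headed n (y , r) × v ∈ concatMap (headed n) l → ⊥
      disjoint (v∈₁ , v∈₂) with find (Any.concatMap⁻ (headed n) {xs = l} v∈₂)
      ... | (y′ , r′) , q∈ , v∈₂′ with ∈-map⁻ (y ∷_) v∈₁ | ∈-map⁻ (y′ ∷_) v∈₂′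
      ... | _ , _ , refl | _ , _ , v≡ = All.lookup y∉ (∈-map⁺ proj₁ q∈) (∷-injectiveˡ v≡)

record FreshEmbedding (q K : ℕ) (D : Fin K) : Set where
  field
    E : Fin K
    ι : Fin q → Fin K
    ι-injective : ∀ {x y} → ι x ≡ ι y → x ≡ y
    D≢E : D ≢ E
    ι≢D : ∀ x → ι x ≢ D
    ι≢E : ∀ x → ι x ≢ E

freshEmbedding : ∀ {q} (D : Fin (2 + q)) → FreshEmbedding q (2 + q) D
freshEmbedding D = record
  { E = punchIn D zero
  ; ι = λ x → punchIn D (punchIn zero x)
  ; ι-injective = λ eq → punchIn-injective zero _ _ (punchIn-injective D _ _ eq)
  ; D≢E = λ D≡ → punchInᵢ≢i D zero (sym D≡)
  ; ι≢D = λ x → punchInᵢ≢i D (punchIn zero x)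
  ; ι≢E = λ x eq → punchInᵢ≢i zero x (punchIn-injective D _ _ eq)
  }

module Construction {q K : ℕ} (k : ℕ) (d : Fin q) (D : Fin K) (fresh : FreshEmbedding q K D) where

  open FreshEmbedding fresh
  open Separated _≟_ E

  S : List (Fin q) → Set
  S = InS (3 + k) q d

  relabel : Fin q → Fin K
  relabel x with x ≟ d
  ... | yes _ = D
  ... | no _ = ι x

  relabel-injective : ∀ {x y} → relabel x ≡ relabel y → x ≡ y
  relabel-injective {x} {y} eq with x ≟ d | y ≟ d
  ... | yes x≡d | yes y≡d = trans x≡d (sym y≡d)
  ... | yes _ | no _ = ⊥-elim (ι≢D y (sym eq))
  ... | no _ | yes _ = ⊥-elim (ι≢D x eq)
  ... | no _ | no _ = ι-injective eq

  relabel≢E : ∀ x → relabel x ≢ E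
  relabel≢E x with x ≟ d
  ... | yes _ = D≢E
  ... | no _ = ι≢E x

  relabel≢ιd : ∀ x → relabel x ≢ ι d
  relabel≢ιd x with x ≟ d
  ... | yes _ = λ D≡ιd → ι≢D d (sym D≡ιd)
  ... | no x≢d = λ ιx≡ιd → x≢d (ι-injective ιx≡ιd)

  relabel-d : relabel d ≡ D
  relabel-d with d ≟ d
  ... | yes _ = refl
  ... | no d≢d = ⊥-elim (d≢d refl)

  -- Each block starts with a letter occurring nowhere else in it.
  plainBlock : List (Fin q) → List (Fin K)
  plainBlock b = D ∷ map ι b

  relabelBlock : List (Fin q) → List (Fin K)
  relabelBlock h = ι d ∷ map relabel h

  blocks : List (List (Fin q)) → List (List (Fin q)) → List (List (Fin K))
  blocks (b ∷ bs) (h ∷ hs) = relabelBlock h ∷ plainBlock b ∷ blocks bs hs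
  blocks _ _ = []

  word : List (List (Fin q)) → List (List (Fin q)) → List (Fin K)
  word [] _ = []
  word (b ∷ bs) hs = glue (plainBlock b) (blocks bs hs)

  E∉plainBlock : ∀ b → E ∉ plainBlock b
  E∉plainBlock b (here E≡D) = D≢E (sym E≡D)
  E∉plainBlock b (there E∈) = ∉-map ι ι≢E E∈

  E∉relabelBlock : ∀ h → E ∉ relabelBlock h
  E∉relabelBlock h (here E≡ιd) = ι≢E d (sym E≡ιd)
  E∉relabelBlock h (there E∈) = ∉-map relabel relabel≢E E∈

  E∉blocks : ∀ bs hs → All (E ∉_) (blocks bs hs)
  E∉blocks (b ∷ bs) (h ∷ hs) = E∉relabelBlock h ∷ E∉plainBlock b ∷ E∉blocks bs hs
  E∉blocks [] _ = []
  E∉blocks (_ ∷ _) [] = []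

  ∈-blocks⁻ : ∀ bs hs {s} → s ∈ blocks bs hs →
    (∃[ b ] (b ∈ bs × s ≡ plainBlock b)) ⊎ (∃[ h ] (h ∈ hs × s ≡ relabelBlock h))
  ∈-blocks⁻ (b ∷ bs) (h ∷ hs) (here refl) = inj₂ (h , here refl , refl)
  ∈-blocks⁻ (b ∷ bs) (h ∷ hs) (there (here refl)) = inj₁ (b , here refl , refl)
  ∈-blocks⁻ (b ∷ bs) (h ∷ hs) (there (there s∈)) with ∈-blocks⁻ bs hs s∈
  ... | inj₁ (b′ , b′∈ , s≡) = inj₁ (b′ , there b′∈ , s≡)
  ... | inj₂ (h′ , h′∈ , s≡) = inj₂ (h′ , there h′∈ , s≡)

  plainBlock-injective : ∀ {b b′} → plainBlock b ≡ plainBlock b′ → b ≡ b′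
  plainBlock-injective eq = map-injective ι-injective (∷-injectiveʳ eq)

  relabelBlock-injective : ∀ {h h′} → relabelBlock h ≡ relabelBlock h′ → h ≡ h′
  relabelBlock-injective eq = map-injective relabel-injective (∷-injectiveʳ eq)

  plainBlock≢relabelBlock : ∀ b h → plainBlock b ≢ relabelBlock h
  plainBlock≢relabelBlock b h eq = ι≢D d (sym (∷-injectiveˡ eq))

  plainBlock∉blocks : ∀ {b} bs hs → b ∉ bs → All (plainBlock b ≢_) (blocks bs hs)
  plainBlock∉blocks {b} bs hs b∉ = All.tabulate λ s∈ → differ (∈-blocks⁻ bs hs s∈)
    where
    differ : ∀ {s} → (∃[ b′ ] (b′ ∈ bs × s ≡ plainBlock b′)) ⊎ (∃[ h ] (h ∈ hs × s ≡ relabelBlock h)) →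
      plainBlock b ≢ s
    differ (inj₁ (b′ , b′∈ , refl)) eq = b∉ (subst (_∈ bs) (sym (plainBlock-injective eq)) b′∈)
    differ (inj₂ (h , _ , refl)) eq = plainBlock≢relabelBlock b h eq

  relabelBlock∉blocks : ∀ {h} bs hs → h ∉ hs → All (relabelBlock h ≢_) (blocks bs hs)
  relabelBlock∉blocks {h} bs hs h∉ = All.tabulate λ s∈ → differ (∈-blocks⁻ bs hs s∈)
    where
    differ : ∀ {s} → (∃[ b ] (b ∈ bs × s ≡ plainBlock b)) ⊎ (∃[ h′ ] (h′ ∈ hs × s ≡ relabelBlock h′)) →
      relabelBlock h ≢ s
    differ (inj₁ (b , _ , refl)) eq = plainBlock≢relabelBlock b h (sym eq)
    differ (inj₂ (h′ , h′∈ , refl)) eq = h∉ (subst (_∈ hs) (sym (relabelBlock-injective eq)) h′∈)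

  blocks-unique : ∀ bs hs → Unique bs → Unique hs → Unique (blocks bs hs)
  blocks-unique (b ∷ bs) (h ∷ hs) distinct-bs@(_ ∷ distinct-bs′) distinct-hs@(_ ∷ distinct-hs′) =
    ((λ eq → plainBlock≢relabelBlock b h (sym eq)) ∷ relabelBlock∉blocks bs hs (Unique[x∷xs]⇒x∉xs distinct-hs))
    ∷ (plainBlock∉blocks bs hs (Unique[x∷xs]⇒x∉xs distinct-bs) ∷ blocks-unique bs hs distinct-bs′ distinct-hs′)
  blocks-unique [] _ _ _ = []
  blocks-unique (_ ∷ _) [] _ _ = []

  IsPlainBlock IsRelabelBlock : List (Fin K) → Set
  IsPlainBlock s = ∃[ b ] (s ≡ plainBlock b × S b)
  IsRelabelBlock s = ∃[ h ] (s ≡ relabelBlock h × S h)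

  image-in-plainBlock : ∀ j {P b} → ZiminImage (2 + j) P → Subword P (plainBlock b) →
    ∃[ P′ ] (map ι P′ ≡ P × Subword P′ b)
  image-in-plainBlock j P-img P⊑ = subword-map⁻ ι (ZiminImage-∷ j P-img (∉-map ι ι≢D) P⊑)

  image-in-relabelBlock : ∀ j {P h} → ZiminImage (2 + j) P → Subword P (relabelBlock h) →
    ∃[ P′ ] (map relabel P′ ≡ P × Subword P′ h)
  image-in-relabelBlock j P-img P⊑ = subword-map⁻ relabel (ZiminImage-∷ j P-img (∉-map relabel relabel≢ιd) P⊑)

  no-image-in-block : ∀ {P s} → ZiminImage (3 + k) P → IsPlainBlock s ⊎ IsRelabelBlock s →
    Subword P s → ⊥
  no-image-in-block P-img (inj₁ (b , refl , b∈S)) P⊑ with image-in-plainBlock (suc k) P-img P⊑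
  ... | P′ , refl , P′⊑b = proj₁ b∈S (image⇒contains _ (ZiminImage-map⁻ ι ι-injective _ P-img refl) P′⊑b)
  no-image-in-block P-img (inj₂ (h , refl , h∈S)) P⊑ with image-in-relabelBlock (suc k) P-img P⊑
  ... | P′ , refl , P′⊑h = proj₁ h∈S (image⇒contains _ (ZiminImage-map⁻ relabel relabel-injective _ P-img refl) P′⊑h)

  -- An image in a plain block avoids D, and in a relabelled block this forces it to avoid d.
  no-common-image : ∀ {P s t} → ZiminImage (2 + k) P → IsPlainBlock s → IsRelabelBlock t →
    Subword P s → Subword P t → ⊥
  no-common-image P-img (b , refl , _) (h , refl , h∈S) P⊑s P⊑t
    with image-in-plainBlock k P-img P⊑s | image-in-relabelBlock k P-img P⊑t
  ... | P′ , refl , _ | P″ , P″≡ , P″⊑h =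
    proj₂ h∈S P″ P″⊑h d∉P″
      (image⇒contains _ (ZiminImage-map⁻ relabel relabel-injective _ P-img P″≡) (subword-refl P″))
    where
    d∉P″ : d ∉ P″
    d∉P″ d∈ = ∉-map ι ι≢D (subst (_∈ map ι P′) relabel-d (subst (relabel d ∈_) P″≡ (∈-map⁺ relabel d∈)))

  module _ (b₀ : List (Fin q)) (bs hs : List (List (Fin q)))
           (b₀∷bs∈S : All S (b₀ ∷ bs)) (hs∈S : All S hs) where

    stretch-kind : ∀ {s} → s ∈ plainBlock b₀ ∷ blocks bs hs → IsPlainBlock s ⊎ IsRelabelBlock s
    stretch-kind (here refl) = inj₁ (b₀ , refl , All.head b₀∷bs∈S)
    stretch-kind (there s∈) with ∈-blocks⁻ bs hs s∈
    ... | inj₁ (b , b∈ , s≡) = inj₁ (b , s≡ , All.lookup (All.tail b₀∷bs∈S) b∈)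
    ... | inj₂ (h , h∈ , s≡) = inj₂ (h , s≡ , All.lookup hs∈S h∈)

    adjacent-kinds : ∀ {s t} → Adjacent s t (plainBlock b₀) (blocks bs hs) →
      (IsPlainBlock s × IsRelabelBlock t) ⊎ (IsRelabelBlock s × IsPlainBlock t)
    adjacent-kinds {s} {t} adj = kinds b₀ bs hs b₀∷bs∈S hs∈S adj
      where
      kinds : ∀ b₀ bs hs → All S (b₀ ∷ bs) → All S hs → Adjacent s t (plainBlock b₀) (blocks bs hs) →
        (IsPlainBlock s × IsRelabelBlock t) ⊎ (IsRelabelBlock s × IsPlainBlock t)
      kinds b₀ (b ∷ bs) (h ∷ hs) (b₀∈S ∷ _) (h∈S ∷ _) here = inj₁ ((b₀ , refl , b₀∈S) , (h , refl , h∈S))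
      kinds b₀ (b ∷ bs) (h ∷ hs) (_ ∷ b∈S ∷ _) (h∈S ∷ _) (there here) = inj₂ ((h , refl , h∈S) , (b , refl , b∈S))
      kinds b₀ (b ∷ bs) (h ∷ hs) (_ ∷ bs∈S) (_ ∷ hs∈S) (there (there adj)) = kinds b bs hs bs∈S hs∈S adj

    W : List (Fin K)
    W = glue (plainBlock b₀) (blocks bs hs)

    E∉stretches : All (E ∉_) (plainBlock b₀ ∷ blocks bs hs)
    E∉stretches = E∉plainBlock b₀ ∷ E∉blocks bs hs

    no-image-with-one-E : ∀ {P} → ZiminImage (3 + k) P → occurrences P ≤ 1 → Subword P W → ⊥
    no-image-with-one-E P-img #≤1 P⊑ with glue-subword (plainBlock b₀) (blocks bs hs) P⊑ #≤1
    ... | inj₁ (s , s∈ , P⊑s) = no-image-in-block P-img (stretch-kind s∈) P⊑s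
    ... | inj₂ (s , t , a₁ , a₂ , adj , P≡ , a₁⊑s , a₂⊑t) with P-img
    ... | X , y , X-img , _ , refl
      with square-around-c X y a₁ a₂ (occurrences≤1-square X y #≤1) P≡
    ... | p , r , refl , refl with adjacent-kinds adj
    ... | inj₁ (plain-s , relabel-t) =
      no-common-image X-img plain-s relabel-t
        (subword-trans (subword-prefix X p) a₁⊑s) (subword-trans (subword-suffix r X) a₂⊑t)
    ... | inj₂ (relabel-s , plain-t) =
      no-common-image X-img plain-t relabel-s
        (subword-trans (subword-suffix r X) a₂⊑t) (subword-trans (subword-prefix X p) a₁⊑s)

    stretches-unique : Unique (b₀ ∷ bs) → Unique hs → Unique (plainBlock b₀ ∷ blocks bs hs)
    stretches-unique distinct-bs@(_ ∷ distinct-bs′) distinct-hs =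
      plainBlock∉blocks bs hs (Unique[x∷xs]⇒x∉xs distinct-bs) ∷ blocks-unique bs hs distinct-bs′ distinct-hs

    -- Two E's in X would make the factor E s E occur twice in W.
    W-avoids-Zimin : Unique (b₀ ∷ bs) → Unique hs → Avoids W (Zimin (4 + k))
    W-avoids-Zimin distinct-bs distinct-hs Z⊑W with contains⇒image (4 + k) Z⊑W
    ... | _ , (X , y , X-img , y≢[] , refl) , (u , v , eq) with occurrences X ≤? 1
    ... | yes #≤1 = no-image-with-one-E X-img #≤1 (subword-trans (subword-prefix X (y ++ X)) (u , v , eq))
    ... | no #≰1 with first-two-occurrences X (≰⇒> #≰1)
    ... | a , s , b , refl , E∉a , E∉s =
      y≢[] (++-conicalʳ X y (++-identityˡ-unique (X ++ y)
        (++-cancelˡ u a ((X ++ y) ++ a) (trans same-position (++-assoc u (X ++ y) a)))))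
      where
      open import Algebra.Solver.Monoid (++-monoid (Fin K)) using (solve; _⊕_; _⊜_)
      first : W ≡ (u ++ a) ++ E ∷ s ++ E ∷ (b ++ y ++ X ++ v)
      first = trans (sym eq) (solve 7 (λ u a e s b y v →
        u ⊕ ((a ⊕ e ⊕ s ⊕ e ⊕ b) ⊕ y ⊕ (a ⊕ e ⊕ s ⊕ e ⊕ b)) ⊕ v ⊜
        (u ⊕ a) ⊕ e ⊕ s ⊕ e ⊕ (b ⊕ y ⊕ (a ⊕ e ⊕ s ⊕ e ⊕ b) ⊕ v)) refl u a (E ∷ []) s b y v)
      second : W ≡ ((u ++ X ++ y) ++ a) ++ E ∷ s ++ E ∷ (b ++ v)
      second = trans (sym eq) (solve 7 (λ u a e s b y v →
        u ⊕ ((a ⊕ e ⊕ s ⊕ e ⊕ b) ⊕ y ⊕ (a ⊕ e ⊕ s ⊕ e ⊕ b)) ⊕ v ⊜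
        ((u ⊕ (a ⊕ e ⊕ s ⊕ e ⊕ b) ⊕ y) ⊕ a) ⊕ e ⊕ s ⊕ e ⊕ (b ⊕ v)) refl u a (E ∷ []) s b y v)
      same-position : u ++ a ≡ (u ++ X ++ y) ++ a
      same-position = glue-c-stretch-c-unique (plainBlock b₀) (blocks bs hs) _ _ _ _ s
        E∉stretches E∉s (stretches-unique distinct-bs distinct-hs) first second

    -- Two E's in a D-free image force it to end right before a plain block, i.e. with E.
    W-D-free-avoids : ∀ s → Subword s W → D ∉ s → Avoids s (Zimin (3 + k))
    W-D-free-avoids s s⊑W D∉s Z⊑s with contains⇒image (3 + k) Z⊑s
    ... | P , P-img , P⊑s with occurrences P ≤? 1
    ... | yes #≤1 = no-image-with-one-E P-img #≤1 (subword-trans P⊑s s⊑W)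
    ... | no #≰1 with first-two-occurrences P (≰⇒> #≰1) | subword-trans P⊑s s⊑W
    ... | a , s′ , b , refl , E∉a , E∉s′ | u , v , eq
      with glue-between-c (plainBlock b₀) (blocks bs hs) (u ++ a) s′ (b ++ v) E∉stretches E∉s′ position
      where
      open import Algebra.Solver.Monoid (++-monoid (Fin K)) using (solve; _⊕_; _⊜_)
      position : W ≡ (u ++ a) ++ E ∷ s′ ++ E ∷ (b ++ v)
      position = trans (sym eq) (solve 6 (λ u a e s b v →
        u ⊕ (a ⊕ e ⊕ s ⊕ e ⊕ b) ⊕ v ⊜ (u ⊕ a) ⊕ e ⊕ s ⊕ e ⊕ (b ⊕ v)) refl u a (E ∷ []) s′ b v)
    ... | _ , t , ts , adj , bv≡ with adjacent-kinds adj
    ... | inj₁ ((_ , refl , _) , _) = subword-∉ P⊑s D∉s (∈-++⁺ʳ a (there (here refl)))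
    ... | inj₂ (_ , (b′ , refl , _)) with glue-∷ D (map ι b′) ts | b
    ... | w , glue≡ | x ∷ _ = subword-∉ P⊑s D∉s (∈-++⁺ʳ a (there (∈-++⁺ʳ s′ (there (here (sym x≡D))))))
      where
      x≡D = ∷-injectiveˡ (trans bv≡ glue≡)
    ... | _ | [] with s≤s (s≤s ()) ← subst (4 ≤_) (occurrences-c-s-c a s′ E∉a E∉s′)
      (≤-trans (^-monoʳ-≤ 2 {2} {2 + k} (s≤s (s≤s z≤n)))
               (ZiminImage-ending-in-c (2 + k) P-img (sym (++-assoc a (E ∷ s′) (E ∷ [])))))

  blocks-injective : ∀ bs bs′ hs → length bs ≡ length bs′ → length bs ≤ length hs →
    blocks bs hs ≡ blocks bs′ hs → bs ≡ bs′
  blocks-injective [] [] _ _ _ _ = refl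
  blocks-injective (b ∷ bs) (b′ ∷ bs′) (h ∷ hs) len≡ (s≤s len≤) eq =
    cong₂ _∷_ (plainBlock-injective (∷-injectiveˡ (∷-injectiveʳ eq)))
              (blocks-injective bs bs′ hs (suc-injective len≡) len≤ (∷-injectiveʳ (∷-injectiveʳ eq)))

  word-injective : ∀ bs bs′ hs → length bs ≡ length bs′ → length bs ≤ suc (length hs) →
    word bs hs ≡ word bs′ hs → bs ≡ bs′
  word-injective [] [] _ _ _ _ = refl
  word-injective (b ∷ bs) (b′ ∷ bs′) hs len≡ (s≤s len≤) eq
    with glue-injective (plainBlock b) (blocks bs hs) (plainBlock b′) (blocks bs′ hs)
           (E∉plainBlock b ∷ E∉blocks bs hs) (E∉plainBlock b′ ∷ E∉blocks bs′ hs) eq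
  ... | head≡ , blocks≡ =
    cong₂ _∷_ (plainBlock-injective head≡) (blocks-injective bs bs′ hs (suc-injective len≡) len≤ blocks≡)

  length-blocks : ∀ bs hs → length bs ≤ length hs → length bs ≤ length (blocks bs hs)
  length-blocks [] _ _ = z≤n
  length-blocks (b ∷ bs) (h ∷ hs) (s≤s len≤) = s≤s (≤-trans (length-blocks bs hs len≤) (n≤1+n _))

  length-word : ∀ bs hs → length bs ≤ suc (length hs) → length bs ≤ length (word bs hs)
  length-word [] _ _ = z≤n
  length-word (b ∷ bs) hs (s≤s len≤) =
    ≤-trans (+-mono-≤ (s≤s z≤n) (length-blocks bs hs len≤)) (length-glue (plainBlock b) (blocks bs hs))

  word∈S : ∀ bs hs → Unique bs → All S bs → Unique hs → All S hs → InS (4 + k) K D (word bs hs)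
  word∈S [] _ _ _ _ _ = []∈S (2 + k) D
  word∈S (b ∷ bs) hs distinct-bs bs∈S distinct-hs hs∈S =
    W-avoids-Zimin b bs hs bs∈S hs∈S distinct-bs distinct-hs , W-D-free-avoids b bs hs bs∈S hs∈S

Unique-⊆⇒length-≤ : {A : Set} {xs ys : List A} → Unique xs → All (_∈ ys) xs → length xs ≤ length ys
Unique-⊆⇒length-≤ {xs = []} _ _ = z≤n
Unique-⊆⇒length-≤ {xs = x ∷ xs} (x∉xs ∷ distinct) (x∈ys ∷ xs⊆ys) with ∈-∃++ x∈ys
... | ys₁ , ys₂ , refl = subst (suc (length xs) ≤_) (sym length-ys)
  (s≤s (Unique-⊆⇒length-≤ distinct (All.tabulate ∈-rest)))
  where
  length-ys : length (ys₁ ++ x ∷ ys₂) ≡ suc (length (ys₁ ++ ys₂))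
  length-ys = trans (length-++ ys₁) (trans (+-suc (length ys₁) (length ys₂)) (cong suc (sym (length-++ ys₁))))
  ∈-rest : ∀ {z} → z ∈ xs → z ∈ ys₁ ++ ys₂
  ∈-rest {z} z∈ with ∈-++⁻ ys₁ (All.lookup xs⊆ys z∈)
  ... | inj₁ z∈ys₁ = ∈-++⁺ˡ z∈ys₁
  ... | inj₂ (here refl) = ⊥-elim (All.lookup x∉xs z∈ refl)
  ... | inj₂ (there z∈ys₂) = ∈-++⁺ʳ ys₁ z∈ys₂

-- Words of S(2,q) use only d (other letters are Z₁-images) and avoid ddd.
S₂-candidates : ∀ {q} → Fin q → List (List (Fin q))
S₂-candidates d = [] ∷ (d ∷ []) ∷ (d ∷ d ∷ []) ∷ []

∈S₂⇒letter≡d : ∀ {q} {d : Fin q} {w x} → InS 2 q d w → x ∈ w → x ≡ d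
∈S₂⇒letter≡d {d = d} {x = x} (_ , free) x∈ with x ≟ d
... | yes x≡d = x≡d
... | no x≢d with ∈-∃++ x∈
... | u , v , refl = ⊥-elim (free (x ∷ []) (u , v , refl) (λ { (here d≡x) → x≢d (sym d≡x) })
                                 ((λ _ → x ∷ []) , (λ _ _ ()) , [] , [] , refl))

∈S₂⇒candidate : ∀ {q} (d : Fin q) w → InS 2 q d w → w ∈ S₂-candidates d
∈S₂⇒candidate d [] _ = here refl
∈S₂⇒candidate d (x ∷ []) w∈S with refl ← ∈S₂⇒letter≡d w∈S (here refl) = there (here refl)
∈S₂⇒candidate d (x ∷ y ∷ []) w∈S
  with refl ← ∈S₂⇒letter≡d w∈S (here refl) | refl ← ∈S₂⇒letter≡d w∈S (there (here refl)) =
  there (there (here refl))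
∈S₂⇒candidate d (x ∷ y ∷ z ∷ w) w∈S
  with refl ← ∈S₂⇒letter≡d w∈S (here refl) | refl ← ∈S₂⇒letter≡d w∈S (there (here refl))
     | refl ← ∈S₂⇒letter≡d w∈S (there (there (here refl))) =
  ⊥-elim (proj₁ w∈S ((λ _ → d ∷ []) , (λ _ _ ()) , [] , w , refl))

replicate∈S₃ : ∀ {K} (D : Fin K) j → j < 7 → InS 3 K D (replicate j D)
replicate∈S₃ D j j<7 = avoids-shorter (subst (_< 7) (sym (length-replicate j)) j<7) , D-free-empty
  where
  D-free-empty : ∀ s → Subword s (replicate j D) → D ∉ s → Avoids s (Zimin 2)
  D-free-empty [] _ _ = avoids-shorter (s≤s z≤n)
  D-free-empty (x ∷ s) (u , v , eq) D∉ _ =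
    D∉ (here (sym (All.lookup (All.replicate⁺ {P = _≡ D} j refl) (subst (x ∈_) eq (∈-++⁺ʳ u (here refl))))))

LowerBoundWitnesses : (n K : ℕ) → Fin K → ℕ → Set
LowerBoundWitnesses n K D m =
  (Σ (List (Word (Fin K))) λ L → Unique L × All (InS n K D) L × (m ! ≤ length L))
  × (∃[ w ] (InS n K D w × (m ≤ length w)))

lower-bounds-2 : ∀ {q K} (d : Fin q) (D : Fin K) m → HasSizeM 2 q d m → LowerBoundWitnesses 3 K D m
lower-bounds-2 d D _ (L , distinct , L⇔S , refl) =
  (Ds , Unique.map⁺ replicate-injective (upTo⁺ 6) , All.map⁺ (All.tabulate Ds∈S) , ∣⇒≤ (m≤n⇒m!∣n! |L|≤3)) ,
  (replicate 3 D , replicate∈S₃ D 3 (s≤s (s≤s (s≤s (s≤s z≤n)))) , |L|≤3)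
  where
  |L|≤3 : length L ≤ 3
  |L|≤3 = Unique-⊆⇒length-≤ distinct (All.tabulate λ {w} w∈ → ∈S₂⇒candidate d w (Equivalence.to (L⇔S w) w∈))
  Ds : List (List _)
  Ds = map (λ j → replicate (suc j) D) (upTo 6)
  replicate-injective : ∀ {i j} → replicate (suc i) D ≡ replicate (suc j) D → i ≡ j
  replicate-injective {i} {j} eq =
    suc-injective (trans (sym (length-replicate (suc i))) (trans (cong length eq) (length-replicate (suc j))))
  Ds∈S : ∀ {j} → j ∈ upTo 6 → InS 3 _ D (replicate (suc j) D)
  Ds∈S j∈ = replicate∈S₃ D _ (s≤s (∈-upTo⁻ j∈))

lower-bounds-≥3 : ∀ k {q K} (d : Fin q) (D : Fin K) → FreshEmbedding q K D →
  ∀ m → HasSizeM (3 + k) q d m → LowerBoundWitnesses (4 + k) K D m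
lower-bounds-≥3 k d D fresh _ (Ls , distinct , Ls⇔S , refl) =
  (map (λ p → word p Ls) perms , unique , All.map⁺ (All.tabulate (λ p∈ → arrangement∈S (arrangement p∈))) ,
   ≤-reflexive (sym (trans (length-map _ perms) (length-permutations m Ls refl)))) ,
  (word Ls Ls , arrangement∈S (distinct , All.tabulate (λ w∈ → w∈) , refl) , length-word Ls Ls (n≤1+n m))
  where
  open Construction k d D fresh
  open Permutations
  m = length Ls
  perms = permutations m Ls
  Ls∈S : All S Ls
  Ls∈S = All.tabulate λ {w} w∈ → Equivalence.to (Ls⇔S w) w∈
  arrangement : ∀ {p} → p ∈ perms → Arrangement Ls m p
  arrangement = ∈-permutations⁻ m Ls refl distinct
  arrangement∈S : ∀ {p} → Arrangement Ls m p → InS (4 + k) _ D (word p Ls)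
  arrangement∈S (distinct-p , p⊆Ls , _) = word∈S _ Ls distinct-p (All.map (All.lookup Ls∈S) p⊆Ls) distinct Ls∈S
  length≡m : ∀ {p} → p ∈ perms → length p ≡ m
  length≡m p∈ = proj₂ (proj₂ (arrangement p∈))
  unique : Unique (map (λ p → word p Ls) perms)
  unique = Unique-map⁺-on _
    (λ p∈ p′∈ → word-injective _ _ Ls (trans (length≡m p∈) (sym (length≡m p′∈)))
                                      (≤-trans (≤-reflexive (length≡m p∈)) (n≤1+n m)))
    (permutations-unique m Ls refl distinct)

lemma4p1 : (n q : ℕ) → 2 ≤ n → 1 ≤ q →
    (d : Fin q) (d′ : Fin (q + 2)) (m : ℕ) → HasSizeM n q d m →
    (Σ (List (Word (Fin (q + 2)))) λ L →
        Unique L × All (InS (suc n) (q + 2) d′) L × (m ! ≤ length L))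
    × (∃[ w ] (InS (suc n) (q + 2) d′ w × (m ≤ length w)))
lemma4p1 (suc zero) _ (s≤s ()) _ _ _ _
lemma4p1 (suc (suc zero)) q _ _ d d′ m = lower-bounds-2 d d′ m
lemma4p1 (suc (suc (suc k))) q _ _ d d′ m = lower-bounds-≥3 k d d′ (fresh (q + 2) (+-comm q 2) d′) m
  where
  fresh : ∀ K → K ≡ 2 + q → (D : Fin K) → FreshEmbedding q K D
  fresh _ refl = freshEmbedding
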